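{- Let $\mathcal{A}$ be a DMF-algebra and let $\nabla_{\mathcal{A}}=\{x\vee\lnot x: x\in A\}$ $(=[n,1])$, regarded as a bounded distributive lattice with the meet and join of $\mathcal{A}$, bottom $n$ and top $1$. Then there is an injective homomorphism of DMF-algebras $\varphi:\mathcal{A}\to\pi(\nabla_{\mathcal{A}})$ (namely $\varphi(x)=(x\vee n,\lnot x\vee n)$).
   Context: A DMF-algebra is an algebra $(A,\wedge,\vee,\lnot,0,1,n)$ such that $(A,\wedge,\vee,0,1)$ is a bounded distributive lattice, $\lnot\lnot x=x$, $\lnot(x\wedge y)=\lnot x\vee\lnot y$, $x\wedge\lnot x\le y\vee\lnot y$, and $\lnot n=n$. For a bounded distributive lattice $\mathcal{L}$ with bottom $0_{\mathcal{L}}$ and top $1_{\mathcal{L}}$, $\pi(\mathcal{L})$ is the DMF-algebra on $\{(a,b)\in L\times L: a\wedge b=0_{\mathcal{L}}\}$ with $(x,y)\wedge(z,w)=(x\wedge z,y\vee w)$, $(x,y)\vee(z,w)=(x\vee z,y\wedge w)$, $\lnot(x,y)=(y,x)$, $0=(0_{\mathcal{L}},1_{\mathcal{L}})$, $1=(1_{\mathcal{L}},0_{\mathcal{L}})$, $n=(0_{\mathcal{L}},0_{\mathcal{L}})$. -}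

module Defs where

open import Level using (Level; _⊔_; suc)
open import Data.Product using (Σ; ∃; _×_; _,_; proj₁; proj₂)
open import Relation.Binary.Core using (Rel)
open import Algebra.Core using (Op₁; Op₂)
open import Algebra.Definitions using (Congruent₁)
open import Algebra.Lattice.Structures using (IsDistributiveLattice)

record DMFAlgebra (c ℓ : Level) : Set (suc (c ⊔ ℓ)) where
  infix  4 _≈_ _≤_
  infix  8 ¬_
  infixr 7 _∧_
  infixr 6 _∨_
  field
    Carrier : Set c
    _≈_     : Rel Carrier ℓ
    _∧_     : Op₂ Carrier
    _∨_     : Op₂ Carrier
    ¬_      : Op₁ Carrier
    𝟘       : Carrier
    𝟙       : Carrier
    n       : Carrier
    isDistributiveLattice : IsDistributiveLattice _≈_ _∨_ _∧_
    ∨-identityʳ : ∀ x → (x ∨ 𝟘) ≈ x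
    ∧-identityʳ : ∀ x → (x ∧ 𝟙) ≈ x
    ¬-cong      : Congruent₁ _≈_ ¬_
    ¬-involutive : ∀ x → ¬ (¬ x) ≈ x
    ¬-∧         : ∀ x y → ¬ (x ∧ y) ≈ (¬ x ∨ ¬ y)
    -- x ∧ ¬ x ≤ y ∨ ¬ y, with u ≤ v meaning u ∧ v ≈ u
    kleene      : ∀ x y → ((x ∧ ¬ x) ∧ (y ∨ ¬ y)) ≈ (x ∧ ¬ x)
    ¬n≈n        : ¬ n ≈ n

  _≤_ : Rel Carrier ℓ
  _≤_ x y = (x ∧ y) ≈ x

module _ {c ℓ : Level} (𝒜 : DMFAlgebra c ℓ) where
  open DMFAlgebra 𝒜

  InNabla : Carrier → Set (c ⊔ ℓ)
  InNabla a = ∃ λ x → a ≈ (x ∨ ¬ x)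

  PiNabla : Set (c ⊔ ℓ)
  PiNabla = Σ (Carrier × Carrier) λ p →
    InNabla (proj₁ p) × InNabla (proj₂ p) × ((proj₁ p ∧ proj₂ p) ≈ n)

  _≈π_ : PiNabla → PiNabla → Set ℓ
  _≈π_ ((a , b) , _) ((c' , d) , _) = (a ≈ c') × (b ≈ d)

  _∧π_ : Carrier × Carrier → Carrier × Carrier → Carrier × Carrier
  _∧π_ (x , y) (z , w) = (x ∧ z , y ∨ w)

  _∨π_ : Carrier × Carrier → Carrier × Carrier → Carrier × Carrier
  _∨π_ (x , y) (z , w) = (x ∨ z , y ∧ w)

  ¬π : Carrier × Carrier → Carrier × Carrier
  ¬π (x , y) = (y , x)

  𝟘π 𝟙π nπ : Carrier × Carrier
  𝟘π = (n , 𝟙)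
  𝟙π = (𝟙 , n)
  nπ = (n , n)

  _≈×_ : Carrier × Carrier → Carrier × Carrier → Set ℓ
  _≈×_ (a , b) (c' , d) = (a ≈ c') × (b ≈ d)

  record IsDMFHomToPiNabla (φ : Carrier → PiNabla) : Set (c ⊔ ℓ) where
    field
      cong   : ∀ {x y} → x ≈ y → φ x ≈π φ y
      hom-∧  : ∀ x y → proj₁ (φ (x ∧ y)) ≈× (proj₁ (φ x) ∧π proj₁ (φ y))
      hom-∨  : ∀ x y → proj₁ (φ (x ∨ y)) ≈× (proj₁ (φ x) ∨π proj₁ (φ y))
      hom-¬  : ∀ x → proj₁ (φ (¬ x)) ≈× ¬π (proj₁ (φ x))
      hom-𝟘  : proj₁ (φ 𝟘) ≈× 𝟘π
      hom-𝟙  : proj₁ (φ 𝟙) ≈× 𝟙π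
      hom-n  : proj₁ (φ n) ≈× nπ

  IsInjective : (Carrier → PiNabla) → Set (c ⊔ ℓ)
  IsInjective φ = ∀ {x y} → φ x ≈π φ y → x ≈ y

-- Adjoining n by join maps A into ∇ = [n, 1]: x ∨ n ∈ ∇ because ¬ n = n,
-- and (x ∨ n) ∧ (¬ x ∨ n) = (x ∧ ¬ x) ∨ n = n by the Kleene law x ∧ ¬ x ≤ n ∨ ¬ n.
-- Joining with n preserves ∧ and ∨ and swaps under ¬, so φ is a homomorphism.
-- It is injective because x is determined by x ∨ n together with
-- x ∧ n = ¬ (¬ x ∨ n), by the cancellation law of distributive lattices.
module Submission where

open import Defs
open import Level using (Level)
open import Data.Product using (Σ; _×_; _,_; proj₁)
open import Algebra.Bundles using (IdempotentCommutativeMonoid)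
open import Algebra.Lattice.Bundles using (DistributiveLattice)
open import Algebra.Lattice.Structures using (IsDistributiveLattice)
import Algebra.Lattice.Properties.DistributiveLattice as DistributiveLatticeProperties
import Algebra.Properties.IdempotentCommutativeMonoid as IdempotentCommutativeMonoidProperties
import Relation.Binary.Reasoning.Setoid as SetoidReasoning

module _ {c ℓ : Level} (L : DistributiveLattice c ℓ) where
  open DistributiveLattice L
  open SetoidReasoning setoid

  ∨-∧-cancelʳ : ∀ {x y z} → x ∨ z ≈ y ∨ z → x ∧ z ≈ y ∧ z → x ≈ y
  ∨-∧-cancelʳ {x} {y} {z} x∨z≈y∨z x∧z≈y∧z = begin
    x                 ≈⟨ ∧-absorbs-∨ x z ⟨
    x ∧ (x ∨ z)       ≈⟨ ∧-congˡ x∨z≈y∨z ⟩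
    x ∧ (y ∨ z)       ≈⟨ ∧-distribˡ-∨ x y z ⟩
    (x ∧ y) ∨ (x ∧ z) ≈⟨ ∨-cong (∧-comm x y) x∧z≈y∧z ⟩
    (y ∧ x) ∨ (y ∧ z) ≈⟨ ∧-distribˡ-∨ y x z ⟨
    y ∧ (x ∨ z)       ≈⟨ ∧-congˡ x∨z≈y∨z ⟩
    y ∧ (y ∨ z)       ≈⟨ ∧-absorbs-∨ y z ⟩
    y                 ∎

module DMFProperties {c ℓ : Level} (𝒜 : DMFAlgebra c ℓ) where
  open DMFAlgebra 𝒜

  distributiveLattice : DistributiveLattice c ℓ
  distributiveLattice = record { isDistributiveLattice = isDistributiveLattice }

  open IsDistributiveLattice isDistributiveLattice public
  open DistributiveLattice distributiveLattice public using (setoid)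
  open DistributiveLatticeProperties distributiveLattice public
  open SetoidReasoning setoid

  ∨-identityˡ : ∀ x → 𝟘 ∨ x ≈ x
  ∨-identityˡ x = trans (∨-comm 𝟘 x) (∨-identityʳ x)

  ∨-zeroˡ : ∀ x → 𝟙 ∨ x ≈ 𝟙
  ∨-zeroˡ x = begin
    𝟙 ∨ x       ≈⟨ ∨-congˡ (∧-identityʳ x) ⟨
    𝟙 ∨ (x ∧ 𝟙) ≈⟨ ∨-congˡ (∧-comm x 𝟙) ⟩
    𝟙 ∨ (𝟙 ∧ x) ≈⟨ ∨-absorbs-∧ 𝟙 x ⟩
    𝟙           ∎

  ∨-𝟘-idempotentCommutativeMonoid : IdempotentCommutativeMonoid c ℓ
  ∨-𝟘-idempotentCommutativeMonoid = record
    { isIdempotentCommutativeMonoid = record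
      { isCommutativeMonoid = record
        { isMonoid = record
          { isSemigroup = ∨-isSemigroup
          ; identity    = ∨-identityˡ , ∨-identityʳ
          }
        ; comm = ∨-comm
        }
      ; idem = ∨-idem
      }
    }

  open IdempotentCommutativeMonoidProperties ∨-𝟘-idempotentCommutativeMonoid public
    using () renaming (∙-distrʳ-∙ to ∨-distribʳ-∨)

  ¬-∨ : ∀ x y → ¬ (x ∨ y) ≈ ¬ x ∧ ¬ y
  ¬-∨ x y = begin
    ¬ (x ∨ y)         ≈⟨ ¬-cong (∨-cong (¬-involutive x) (¬-involutive y)) ⟨
    ¬ (¬ ¬ x ∨ ¬ ¬ y) ≈⟨ ¬-cong (¬-∧ (¬ x) (¬ y)) ⟨
    ¬ ¬ (¬ x ∧ ¬ y)   ≈⟨ ¬-involutive _ ⟩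
    ¬ x ∧ ¬ y         ∎

  ¬𝟙≈𝟘 : ¬ 𝟙 ≈ 𝟘
  ¬𝟙≈𝟘 = begin
    ¬ 𝟙           ≈⟨ ∨-identityˡ (¬ 𝟙) ⟨
    𝟘 ∨ ¬ 𝟙       ≈⟨ ∨-congʳ (¬-involutive 𝟘) ⟨
    ¬ ¬ 𝟘 ∨ ¬ 𝟙   ≈⟨ ¬-∧ (¬ 𝟘) 𝟙 ⟨
    ¬ (¬ 𝟘 ∧ 𝟙)   ≈⟨ ¬-cong (∧-identityʳ (¬ 𝟘)) ⟩
    ¬ ¬ 𝟘         ≈⟨ ¬-involutive 𝟘 ⟩
    𝟘             ∎

  ¬𝟘≈𝟙 : ¬ 𝟘 ≈ 𝟙
  ¬𝟘≈𝟙 = trans (¬-cong (sym ¬𝟙≈𝟘)) (¬-involutive 𝟙)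

  n∨¬n≈n : n ∨ ¬ n ≈ n
  n∨¬n≈n = trans (∨-congˡ ¬n≈n) (∨-idem n)

  x∧¬x≤n : ∀ x → (x ∧ ¬ x) ∨ n ≈ n
  x∧¬x≤n x = begin
    (x ∧ ¬ x) ∨ n               ≈⟨ ∨-congʳ (kleene x n) ⟨
    ((x ∧ ¬ x) ∧ (n ∨ ¬ n)) ∨ n ≈⟨ ∨-congʳ (∧-congˡ n∨¬n≈n) ⟩
    ((x ∧ ¬ x) ∧ n) ∨ n         ≈⟨ ∨-comm _ n ⟩
    n ∨ ((x ∧ ¬ x) ∧ n)         ≈⟨ ∨-congˡ (∧-comm _ n) ⟩
    n ∨ (n ∧ (x ∧ ¬ x))         ≈⟨ ∨-absorbs-∧ n _ ⟩
    n                           ∎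

  x∨n∈∇ : ∀ x → InNabla 𝒜 (x ∨ n)
  x∨n∈∇ x = x ∨ n , sym (begin
    (x ∨ n) ∨ ¬ (x ∨ n) ≈⟨ ∨-congˡ (trans (¬-∨ x n) (∧-congˡ ¬n≈n)) ⟩
    (x ∨ n) ∨ (¬ x ∧ n) ≈⟨ ∨-assoc x n _ ⟩
    x ∨ (n ∨ (¬ x ∧ n)) ≈⟨ ∨-congˡ (∨-congˡ (∧-comm (¬ x) n)) ⟩
    x ∨ (n ∨ (n ∧ ¬ x)) ≈⟨ ∨-congˡ (∨-absorbs-∧ n (¬ x)) ⟩
    x ∨ n               ∎)

  x∨n∧¬x∨n≈n : ∀ x → (x ∨ n) ∧ (¬ x ∨ n) ≈ n
  x∨n∧¬x∨n≈n x = trans (sym (∨-distribʳ-∧ n x (¬ x))) (x∧¬x≤n x)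

  ¬[¬x∨n]≈x∧n : ∀ x → ¬ (¬ x ∨ n) ≈ x ∧ n
  ¬[¬x∨n]≈x∧n x = trans (¬-∨ (¬ x) n) (∧-cong (¬-involutive x) ¬n≈n)

module Embedding {c ℓ : Level} (𝒜 : DMFAlgebra c ℓ) where
  open DMFAlgebra 𝒜
  open DMFProperties 𝒜

  φ : Carrier → PiNabla 𝒜
  φ x = (x ∨ n , ¬ x ∨ n) , x∨n∈∇ x , x∨n∈∇ (¬ x) , x∨n∧¬x∨n≈n x

  φ-isHom : IsDMFHomToPiNabla 𝒜 φ
  φ-isHom = record
    { cong  = λ x≈y → ∨-congʳ x≈y , ∨-congʳ (¬-cong x≈y)
    ; hom-∧ = λ x y → ∨-distribʳ-∧ n x y
                    , trans (∨-congʳ (¬-∧ x y)) (∨-distribʳ-∨ n (¬ x) (¬ y))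
    ; hom-∨ = λ x y → ∨-distribʳ-∨ n x y
                    , trans (∨-congʳ (¬-∨ x y)) (∨-distribʳ-∧ n (¬ x) (¬ y))
    ; hom-¬ = λ x → refl , ∨-congʳ (¬-involutive x)
    ; hom-𝟘 = ∨-identityˡ n , trans (∨-congʳ ¬𝟘≈𝟙) (∨-zeroˡ n)
    ; hom-𝟙 = ∨-zeroˡ n , trans (∨-congʳ ¬𝟙≈𝟘) (∨-identityˡ n)
    ; hom-n = ∨-idem n , trans (∨-congʳ ¬n≈n) (∨-idem n)
    }

  φ-injective : IsInjective 𝒜 φ
  φ-injective {x} {y} (x∨n≈y∨n , ¬x∨n≈¬y∨n) =
    ∨-∧-cancelʳ distributiveLattice x∨n≈y∨n x∧n≈y∧n
    where
    x∧n≈y∧n : x ∧ n ≈ y ∧ n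
    x∧n≈y∧n = begin
      x ∧ n         ≈⟨ ¬[¬x∨n]≈x∧n x ⟨
      ¬ (¬ x ∨ n)   ≈⟨ ¬-cong ¬x∨n≈¬y∨n ⟩
      ¬ (¬ y ∨ n)   ≈⟨ ¬[¬x∨n]≈x∧n y ⟩
      y ∧ n         ∎
      where open SetoidReasoning setoid

mainTheorem9 : ∀ {c ℓ : Level} (𝒜 : DMFAlgebra c ℓ) →
    Σ (DMFAlgebra.Carrier 𝒜 → PiNabla 𝒜) (λ φ →
    IsDMFHomToPiNabla 𝒜 φ × IsInjective 𝒜 φ ×
    (∀ x → _≈×_ 𝒜 (proj₁ (φ x))
    (DMFAlgebra._∨_ 𝒜 x (DMFAlgebra.n 𝒜) ,
    DMFAlgebra._∨_ 𝒜 (DMFAlgebra.¬_ 𝒜 x) (DMFAlgebra.n 𝒜))))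
mainTheorem9 𝒜 = φ , φ-isHom , φ-injective , λ _ → refl , refl
  where
  open Embedding 𝒜
  open DMFProperties 𝒜 using (refl)
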